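{- Let $\rho_1,\rho_2\in SC$ with $\rho_1\sim\rho_2$. Then for every $\sigma\in SC$ and every binary relation $\mathcal{B}$ on $SC$, $\rho_2 \models_{\mathcal{B}} \sigma$ implies $\rho_1\models_{\mathcal{B}}\sigma$.
   Context: Fix a set $BT$ of base types with a preorder $\le_:$ and a countable set of labels. Contract terms: $\sigma ::= \mathbf{1} \mid ?t.\sigma \mid !t.\sigma \mid ?(\sigma').\sigma \mid !(\sigma').\sigma \mid \sum_{i\in I} ?l_i.\sigma_i \mid \bigoplus_{i\in I} !l_i.\sigma_i \mid \mu x.\sigma \mid x$ ($t\in BT$, $I$ finite nonempty, labels pairwise distinct). A term is guarded if for every subterm $\mu x.\sigma$, every occurrence of $x$ in $\sigma$ lies under a constructor other than $\mu$; $SC$ is the set of closed guarded terms. Actions: $\mathsf{Act}=\{?l,!l\}\cup\{?t,!t: t\in BT\}\cup\{?(\sigma),!(\sigma):\sigma\in SC\}$. Transitions: $\mathbf{1}\xrightarrow{\mathsf{ok}}$; $\lambda.\sigma\xrightarrow{\lambda}\sigma$ for a prefix $\lambda\in\mathsf{Act}$ (including the one-summand internal sum $!l.\sigma$); $\sum_{i\in I}?l_i.\sigma_i\xrightarrow{?l_k}\sigma_k$ ($k\in I$); $\bigoplus_{i\in I}!l_i.\sigma_i\xrightarrow{\tau}!l_k.\sigma_k$ ($k\in I$, $|I|>1$); $\mu x.\sigma\xrightarrow{\tau}\sigma\{\mu x.\sigma/x\}$; nothing else. For a binary relation $\mathcal{B}$ on $SC$: $\lambda_1\bowtie_{\mathcal{B}}\lambda_2$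 iff $(\lambda_1,\lambda_2)$ is $(!l,?l)$, $(?l,!l)$, $(!t_1,?t_2)$ with $t_1\le_:t_2$, $(?t_1,!t_2)$ with $t_2\le_:t_1$, $(!(\sigma_1),?(\sigma_2))$ with $\sigma_1\mathcal{B}\sigma_2$, or $(?(\sigma_1),!(\sigma_2))$ with $\sigma_2\mathcal{B}\sigma_1$. $\rho\mid\sigma\xrightarrow{\tau}_{\mathcal{B}}\rho'\mid\sigma'$ iff $\rho\xrightarrow{\tau}\rho'$, $\sigma'=\sigma$; or $\sigma\xrightarrow{\tau}\sigma'$, $\rho'=\rho$; or $\rho\xrightarrow{\lambda_1}\rho'$, $\sigma\xrightarrow{\lambda_2}\sigma'$ with $\lambda_1\bowtie_{\mathcal{B}}\lambda_2$. The $\mathcal{B}$-peer compliance $\models_{\mathcal{B}}$ is the largest relation $R\subseteq SC\times SC$ such that whenever $\rho R\sigma$: (i) if $\rho\mid\sigma$ has no $\tau$-transition w.r.t. $\mathcal{B}$ then $\rho\xrightarrow{\mathsf{ok}}$ and $\sigma\xrightarrow{\mathsf{ok}}$; (ii) if $\rho\mid\sigma\xrightarrow{\tau}_{\mathcal{B}}\rho'\mid\sigma'$ then $\rho' R\sigma'$. A strong bisimulation is a relation $R$ on $SC$ such that whenever $\sigma_1 R\sigma_2$: $\sigma_1\xrightarrow{\mathsf{ok}}$ iff $\sigma_2\xrightarrow{\mathsf{ok}}$, and for all $\mu\in\mathsf{Act}\cup\{\tau\}$, $\sigma_1\xrightarrow{\mu}\sigma_1'$ implies $\sigma_2\xrightarrow{\mu}\sigma_2'$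 with $\sigma_1'R\sigma_2'$, and symmetrically; $\sim$ is the union of all strong bisimulations. -}

module Defs where

open import Data.Nat using (ℕ; zero; suc; _≡ᵇ_)
open import Data.Fin using (Fin; zero; suc)
open import Data.Fin.Properties using (_≟_)
open import Data.Bool using (Bool; true; false; _∧_; not; T)
open import Data.List using (List; []; _∷_)
open import Data.Product using (Σ; ∃; _×_; _,_; proj₁)
open import Relation.Nullary using (¬_; does)

Label : Set
Label = ℕ

module Contracts (BT : Set) (_≤:_ : BT → BT → Set) where

  -- Well-scoped contract terms (de Bruijn indices; Term n has n free vars).
  -- An external sum Σ ?lᵢ.σᵢ / internal sum ⊕ !lᵢ.σᵢ carries a nonempty
  -- finite list of branches.  The one-summand internal sum is the prefix !l.σ.
  mutual
    data Term (n : ℕ) : Set where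
      𝟏     : Term n
      inT   : BT → Term n → Term n
      outT  : BT → Term n → Term n
      inS   : Term n → Term n → Term n
      outS  : Term n → Term n → Term n
      ext   : Branches n → Term n
      int   : Branches n → Term n
      rec   : Term (suc n) → Term n             -- μx.σ  (x = index 0)
      var   : Fin n → Term n

    data Branches (n : ℕ) : Set where
      one  : Label → Term n → Branches n
      cons : Label → Term n → Branches n → Branches n

  Ren : ℕ → ℕ → Set
  Ren m n = Fin m → Fin n

  liftR : ∀ {m n} → Ren m n → Ren (suc m) (suc n)
  liftR ρ zero    = zero
  liftR ρ (suc i) = suc (ρ i)

  mutual
    ren : ∀ {m n} → Ren m n → Term m → Term n
    ren ρ 𝟏          = 𝟏
    ren ρ (inT t s)  = inT t (ren ρ s)
    ren ρ (outT t s) = outT t (ren ρ s)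
    ren ρ (inS p s)  = inS (ren ρ p) (ren ρ s)
    ren ρ (outS p s) = outS (ren ρ p) (ren ρ s)
    ren ρ (ext bs)   = ext (renB ρ bs)
    ren ρ (int bs)   = int (renB ρ bs)
    ren ρ (rec s)    = rec (ren (liftR ρ) s)
    ren ρ (var i)    = var (ρ i)

    renB : ∀ {m n} → Ren m n → Branches m → Branches n
    renB ρ (one l s)     = one l (ren ρ s)
    renB ρ (cons l s bs) = cons l (ren ρ s) (renB ρ bs)

  Sub : ℕ → ℕ → Set
  Sub m n = Fin m → Term n

  liftS : ∀ {m n} → Sub m n → Sub (suc m) (suc n)
  liftS θ zero    = var zero
  liftS θ (suc i) = ren suc (θ i)

  mutual
    sub : ∀ {m n} → Sub m n → Term m → Term n
    sub θ 𝟏          = 𝟏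
    sub θ (inT t s)  = inT t (sub θ s)
    sub θ (outT t s) = outT t (sub θ s)
    sub θ (inS p s)  = inS (sub θ p) (sub θ s)
    sub θ (outS p s) = outS (sub θ p) (sub θ s)
    sub θ (ext bs)   = ext (subB θ bs)
    sub θ (int bs)   = int (subB θ bs)
    sub θ (rec s)    = rec (sub (liftS θ) s)
    sub θ (var i)    = θ i

    subB : ∀ {m n} → Sub m n → Branches m → Branches n
    subB θ (one l s)     = one l (sub θ s)
    subB θ (cons l s bs) = cons l (sub θ s) (subB θ bs)

  _[_]₀ : ∀ {n} → Term (suc n) → Term n → Term n
  s [ u ]₀ = sub (λ { zero → u ; (suc i) → var i }) s

  unguarded : ∀ {n} → Fin n → Term n → Bool
  unguarded i (var j) = does (i ≟ j)
  unguarded i (rec s) = unguarded (suc i) s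
  unguarded i _       = false

  elem : ℕ → List ℕ → Bool
  elem x []       = false
  elem x (y ∷ ys) = (x ≡ᵇ y) Data.Bool.∨ elem x ys

  distinct : List ℕ → Bool
  distinct []       = true
  distinct (x ∷ xs) = not (elem x xs) ∧ distinct xs

  labels : ∀ {n} → Branches n → List ℕ
  labels (one l _)     = l ∷ []
  labels (cons l _ bs) = l ∷ labels bs

  mutual
    wf : ∀ {n} → Term n → Bool
    wf 𝟏          = true
    wf (inT t s)  = wf s
    wf (outT t s) = wf s
    wf (inS p s)  = wf p ∧ wf s
    wf (outS p s) = wf p ∧ wf s
    wf (ext bs)   = distinct (labels bs) ∧ wfB bs
    wf (int bs)   = distinct (labels bs) ∧ wfB bs
    wf (rec s)    = not (unguarded zero s) ∧ wf s
    wf (var i)    = true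

    wfB : ∀ {n} → Branches n → Bool
    wfB (one l s)     = wf s
    wfB (cons l s bs) = wf s ∧ wfB bs

  SC : Set
  SC = Σ (Term 0) (λ s → T (wf s))

  data Act : Set where
    inL outL : Label → Act
    inB outB : BT → Act
    inP outP : SC → Act

  data Lab : Set where
    τ   : Lab
    act : Act → Lab

  data Ok : Term 0 → Set where
    ok : Ok 𝟏

  data _∋_,_ {n} : Branches n → Label → Term n → Set where
    here-one  : ∀ {l s} → one l s ∋ l , s
    here-cons : ∀ {l s bs} → cons l s bs ∋ l , s
    there     : ∀ {l s l' s' bs} → bs ∋ l' , s' → cons l s bs ∋ l' , s'

  data _⟶[_]_ : Term 0 → Lab → Term 0 → Set where
    pre-inT  : ∀ {t s} → inT t s ⟶[ act (inB t) ] s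
    pre-outT : ∀ {t s} → outT t s ⟶[ act (outB t) ] s
    pre-inS  : ∀ {p s} (g : T (wf p)) → inS p s ⟶[ act (inP (p , g)) ] s
    pre-outS : ∀ {p s} (g : T (wf p)) → outS p s ⟶[ act (outP (p , g)) ] s
    pre-outL : ∀ {l s} → int (one l s) ⟶[ act (outL l) ] s
    ext-sel  : ∀ {bs l s} → bs ∋ l , s → ext bs ⟶[ act (inL l) ] s
    int-sel  : ∀ {l₀ s₀ bs l s} → cons l₀ s₀ bs ∋ l , s →
               int (cons l₀ s₀ bs) ⟶[ τ ] int (one l s)
    unfold   : ∀ {s} → rec s ⟶[ τ ] (s [ rec s ]₀)

  _⟹[_]_ : SC → Lab → SC → Set
  ρ ⟹[ μ ] ρ' = proj₁ ρ ⟶[ μ ] proj₁ ρ'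

  OK : SC → Set
  OK ρ = Ok (proj₁ ρ)

  Rel : Set₁
  Rel = SC → SC → Set

  data Bowtie (B : Rel) : Act → Act → Set where
    lab-oi : ∀ {l} → Bowtie B (outL l) (inL l)
    lab-io : ∀ {l} → Bowtie B (inL l) (outL l)
    bt-oi  : ∀ {t₁ t₂} → t₁ ≤: t₂ → Bowtie B (outB t₁) (inB t₂)
    bt-io  : ∀ {t₁ t₂} → t₂ ≤: t₁ → Bowtie B (inB t₁) (outB t₂)
    sc-oi  : ∀ {σ₁ σ₂} → B σ₁ σ₂ → Bowtie B (outP σ₁) (inP σ₂)
    sc-io  : ∀ {σ₁ σ₂} → B σ₂ σ₁ → Bowtie B (inP σ₁) (outP σ₂)

  data CStep (B : Rel) (ρ σ : SC) : SC → SC → Set where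
    left  : ∀ {ρ'} → ρ ⟹[ τ ] ρ' → CStep B ρ σ ρ' σ
    right : ∀ {σ'} → σ ⟹[ τ ] σ' → CStep B ρ σ ρ σ'
    sync  : ∀ {ρ' σ' λ₁ λ₂} → ρ ⟹[ act λ₁ ] ρ' → σ ⟹[ act λ₂ ] σ' →
            Bowtie B λ₁ λ₂ → CStep B ρ σ ρ' σ'

  IsCompliance : Rel → Rel → Set
  IsCompliance B R =
    ∀ ρ σ → R ρ σ →
      ((∀ ρ' σ' → ¬ CStep B ρ σ ρ' σ') → OK ρ × OK σ) ×
      (∀ ρ' σ' → CStep B ρ σ ρ' σ' → R ρ' σ')

  -- ⊨_B : the largest such relation (union of all of them)
  _⊨[_]_ : SC → Rel → SC → Set₁
  ρ ⊨[ B ] σ = ∃ λ (R : Rel) → IsCompliance B R × R ρ σ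

  IsBisim : Rel → Set
  IsBisim R =
    ∀ σ₁ σ₂ → R σ₁ σ₂ →
      ((OK σ₁ → OK σ₂) × (OK σ₂ → OK σ₁)) ×
      (∀ μ σ₁' → σ₁ ⟹[ μ ] σ₁' → ∃ λ σ₂' → σ₂ ⟹[ μ ] σ₂' × R σ₁' σ₂') ×
      (∀ μ σ₂' → σ₂ ⟹[ μ ] σ₂' → ∃ λ σ₁' → σ₁ ⟹[ μ ] σ₁' × R σ₁' σ₂')

  -- ∼ : union of all strong bisimulations
  _∼_ : SC → SC → Set₁
  σ₁ ∼ σ₂ = ∃ λ (R : Rel) → IsBisim R × R σ₁ σ₂

-- The composite S ⨾ R of a strong bisimulation S with a B-compliance
-- relation R is again a B-compliance relation.  A step of ρ₁ ∣ σ moves ρ₁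
-- either alone or by an action λ synchronising with σ, and ⋈_B depends only
-- on λ; so it is matched by the same kind of step of ρ₂ ∣ σ with the left
-- components still S-related, and conversely, which also transfers stuckness
-- and termination.  Hence R witnessing ρ₂ ⊨_B σ yields S ⨾ R witnessing ρ₁ ⊨_B σ.
module Submission where

open import Defs
open import Data.Product using (∃; _×_; _,_; proj₁; proj₂)
open import Relation.Binary.PropositionalEquality using (_≡_)
open import Relation.Binary.Structures using (IsPreorder)
open import Relation.Nullary using (¬_)

module BisimulationTransfer {BT : Set} {_≤:_ : BT → BT → Set} where
  open Contracts BT _≤:_

  _⨾_ : Rel → Rel → Rel
  (S ⨾ R) ρ σ = ∃ λ ρ' → S ρ ρ' × R ρ' σ

  module _ {S : Rel} (bisim : IsBisim S) {ρ₁ ρ₂ : SC} (s : S ρ₁ ρ₂) where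

    ok-transfer : OK ρ₂ → OK ρ₁
    ok-transfer = proj₂ (proj₁ (bisim ρ₁ ρ₂ s))

    simulate : ∀ μ ρ₁' → ρ₁ ⟹[ μ ] ρ₁' → ∃ λ ρ₂' → ρ₂ ⟹[ μ ] ρ₂' × S ρ₁' ρ₂'
    simulate = proj₁ (proj₂ (bisim ρ₁ ρ₂ s))

    simulate⁻¹ : ∀ μ ρ₂' → ρ₂ ⟹[ μ ] ρ₂' → ∃ λ ρ₁' → ρ₁ ⟹[ μ ] ρ₁'
    simulate⁻¹ μ ρ₂' t = let ρ₁' , t' , _ = proj₂ (proj₂ (bisim ρ₁ ρ₂ s)) μ ρ₂' t
                         in ρ₁' , t'

    cstep-simulate : ∀ {B σ ρ₁' σ'} → CStep B ρ₁ σ ρ₁' σ' →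
                     ∃ λ ρ₂' → CStep B ρ₂ σ ρ₂' σ' × S ρ₁' ρ₂'
    cstep-simulate {ρ₁' = ρ₁'} (left t) =
      let ρ₂' , t' , s' = simulate τ ρ₁' t in ρ₂' , left t' , s'
    cstep-simulate (right u) = ρ₂ , right u , s
    cstep-simulate {ρ₁' = ρ₁'} (sync {λ₁ = λ₁} t u b) =
      let ρ₂' , t' , s' = simulate (act λ₁) ρ₁' t in ρ₂' , sync t' u b , s'

    cstep-simulate⁻¹ : ∀ {B σ ρ₂' σ'} → CStep B ρ₂ σ ρ₂' σ' →
                       ∃ λ ρ₁' → CStep B ρ₁ σ ρ₁' σ'
    cstep-simulate⁻¹ {ρ₂' = ρ₂'} (left t) =
      let ρ₁' , t' = simulate⁻¹ τ ρ₂' t in ρ₁' , left t'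
    cstep-simulate⁻¹ (right u) = ρ₁ , right u
    cstep-simulate⁻¹ {ρ₂' = ρ₂'} (sync {λ₁ = λ₁} t u b) =
      let ρ₁' , t' = simulate⁻¹ (act λ₁) ρ₂' t in ρ₁' , sync t' u b

    stuck-transfer : ∀ {B σ} → (∀ ρ₁' σ' → ¬ CStep B ρ₁ σ ρ₁' σ') →
                     ∀ ρ₂' σ' → ¬ CStep B ρ₂ σ ρ₂' σ'
    stuck-transfer stuck _ σ' step =
      let ρ₁' , step' = cstep-simulate⁻¹ step in stuck ρ₁' σ' step'

  bisim-⨾-compliance : ∀ {S R B} → IsBisim S → IsCompliance B R →
                       IsCompliance B (S ⨾ R)
  bisim-⨾-compliance {S} {R} {B} bisim comp ρ₁ σ (ρ₂ , s , r) = done , preserved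
    where
    done : (∀ ρ₁' σ' → ¬ CStep B ρ₁ σ ρ₁' σ') → OK ρ₁ × OK σ
    done stuck =
      let ok₂ , okσ = proj₁ (comp ρ₂ σ r) (stuck-transfer bisim s stuck)
      in ok-transfer bisim s ok₂ , okσ

    preserved : ∀ ρ₁' σ' → CStep B ρ₁ σ ρ₁' σ' → (S ⨾ R) ρ₁' σ'
    preserved ρ₁' σ' step =
      let ρ₂' , step' , s' = cstep-simulate bisim s step
      in ρ₂' , s' , proj₂ (comp ρ₂ σ r) ρ₂' σ' step'

open Contracts
open BisimulationTransfer using (_⨾_; bisim-⨾-compliance)

proposition3p4 : (BT : Set) (_≤:_ : BT → BT → Set) → IsPreorder _≡_ _≤:_ →
    (ρ₁ ρ₂ : SC BT _≤:_) → _∼_ BT _≤:_ ρ₁ ρ₂ →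
    (σ : SC BT _≤:_) (B : Rel BT _≤:_) →
    _⊨[_]_ BT _≤:_ ρ₂ B σ → _⊨[_]_ BT _≤:_ ρ₁ B σ
proposition3p4 _ _ _ _ ρ₂ (S , bisim , s) _ _ (R , comp , r) =
  S ⨾ R , bisim-⨾-compliance bisim comp , (ρ₂ , s , r)
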